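{- Let $A$ be a finite set of prisoners with $|A|\ge2$, let $K$ be a finite set of colors with $3\le|K|$, let $V$ be a visibility graph on $A$, and let $I$ be an inning function on $A$ with $IN\ge2$. Suppose the hat game $\mathcal{G}=(A,K,V,I)$ satisfies: (S1) $|I_1|=1$; (S2) for every $a\in A$, $V(a)\cup H(a)=A\setminus\{a\}$. Then there is a predictor for $\mathcal{G}$ such that for every coloring, at most one prisoner guesses incorrectly.
   Context: A hat game $(A,K,V,I)$ consists of: a set $A$ of prisoners and a set $K$ of colors (with $|A|,|K|\ge2$); a visibility graph $V\subseteq A^2$ with no loops, where $(a,b)\in V$ means $a$ sees $b$'s hat, and $V(a)=\{b:(a,b)\in V\}$; and an inning function $I$, a surjection from $A$ onto $\{\beta:1\le\beta\le\alpha\}$ for some nonzero ordinal $\alpha$. Write $IN=\max\operatorname{ran}(I)$, $I_\beta=\{a:I(a)=\beta\}$, and $H(a)=\{b:I(b)<I(a)\}$. A coloring is $f\in K^A$. Strategies: for each $a$, a function $S_a:K^{H(a)}\times K^{V(a)}\to K$; guesses are defined by recursion on $I(a)$ as $\sigma_a(f)=S_a(h_a^f,f\restriction V(a))$ with $h_a^f=(\sigma_b(f))_{b\in H(a)}$. A predictor is $P:K^A\to K^A$ with $P(f)(a)=\sigma_a(f)$ for some family of strategies. Prisoner $a$ guesses incorrectly under $f$ if $P(f)(a)\ne f(a)$. -}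

module Defs where

open import Data.Nat using (ℕ; _≤_; _<_)
open import Data.Fin using (Fin)
open import Data.Bool using (Bool; true; false)
open import Data.Product using (Σ; ∃; _×_)
open import Data.Sum using (_⊎_)
open import Relation.Binary.PropositionalEquality using (_≡_; _≢_)

-- Prisoners A = Fin n, colours K = Fin k.
-- Visibility graph: V a b ≡ true  means  a sees b's hat.
Visibility : ℕ → Set
Visibility n = Fin n → Fin n → Bool

Loopless : ∀ {n} → Visibility n → Set
Loopless {n} V = (a : Fin n) → V a a ≡ false

-- I is an inning function onto {1,…,α}  (α = IN, a finite ordinal since A is finite)
IsInning : ∀ {n} → (Fin n → ℕ) → ℕ → Set
IsInning {n} I α =
  ((a : Fin n) → (1 ≤ I a) × (I a ≤ α)) ×
  ((β : ℕ) → 1 ≤ β → β ≤ α → ∃ λ (a : Fin n) → I a ≡ β)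

Coloring : ℕ → ℕ → Set
Coloring n k = Fin n → Fin k

-- A strategy for prisoner a: S_a : K^{H(a)} × K^{V(a)} → K
Strategy : ∀ {n} (k : ℕ) → Visibility n → (Fin n → ℕ) → Fin n → Set
Strategy {n} k V I a =
  ((b : Fin n) → I b < I a → Fin k) →
  ((b : Fin n) → V a b ≡ true → Fin k) →
  Fin k

-- P is the predictor induced by the family of strategies S:
-- the guesses σ_a(f) = P f a satisfy the defining recursion
-- σ_a(f) = S_a((σ_b(f))_{b ∈ H(a)}, f ↾ V(a)), which determines them uniquely
-- (by recursion on I(a)).
InducedBy : ∀ {n k} (V : Visibility n) (I : Fin n → ℕ) →
  ((a : Fin n) → Strategy k V I a) →
  (Coloring n k → Coloring n k) → Set
InducedBy {n} {k} V I S P =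
  (f : Coloring n k) (a : Fin n) →
  P f a ≡ S a (λ b _ → P f b) (λ b _ → f b)

IsPredictor : ∀ {n k} (V : Visibility n) (I : Fin n → ℕ) →
  (Coloring n k → Coloring n k) → Set
IsPredictor {n} {k} V I P = Σ ((a : Fin n) → Strategy k V I a) λ S → InducedBy V I S P

AtMostOneWrong : ∀ {n k} → (Coloring n k → Coloring n k) → Set
AtMostOneWrong {n} {k} P =
  (f : Coloring n k) (a b : Fin n) → P f a ≢ f a → P f b ≢ f b → a ≡ b

S1 : ∀ {n} → (Fin n → ℕ) → Set
S1 {n} I = Σ (Fin n) λ a → (I a ≡ 1) × ((b : Fin n) → I b ≡ 1 → b ≡ a)

S2 : ∀ {n} → Visibility n → (Fin n → ℕ) → Set
S2 {n} V I = (a b : Fin n) →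
  ((V a b ≡ true ⊎ I b < I a) → b ≢ a) × (b ≢ a → (V a b ≡ true ⊎ I b < I a))

{-# OPTIONS --safe #-}
-- The unique first-inning prisoner a₀ sees every other hat and announces
-- their sum modulo k, sacrificing only himself. Any other prisoner a hears
-- that announcement, and every hat except a₀'s and his own is either seen
-- by a or was guessed, correctly, before him; subtracting these from the
-- announced sum leaves his own colour.
module Submission where

open import Defs
open import Data.Nat using (ℕ; suc; _+_; _*_; _≤_; _<_; _<?_; NonZero)
open import Data.Nat.Properties using (+-assoc; *-comm; <-irrefl; ≤∧≢⇒<; +-0-commutativeMonoid)
open import Data.Nat.DivMod using (_%_; _mod_; %-distribˡ-+; m%n%n≡m%n; [m+kn]%n≡m%n; m<n⇒m%n≡m; m%n<n)
open import Data.Fin using (Fin; toℕ; punchIn)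
open import Data.Fin.Properties using (_≟_; toℕ-injective; toℕ-fromℕ<; toℕ<n; punchInᵢ≢i)
open import Data.Vec.Functional using (Vector; removeAt; updateAt)
open import Data.Vec.Functional.Properties using (updateAt-updates; updateAt-minimal)
open import Algebra.Properties.CommutativeMonoid.Sum +-0-commutativeMonoid using (sum; sum-remove; sum-cong-≗)
open import Data.Product using (Σ; _×_; _,_; proj₁; proj₂)
open import Data.Sum using (inj₁; inj₂)
open import Data.Empty using (⊥-elim)
open import Data.Bool using (true)
open import Data.Bool.Properties using () renaming (_≟_ to _≟ᵇ_)
open import Function using (_∘_; const)
open import Relation.Nullary using (yes; no; contradiction)
open import Relation.Binary.PropositionalEquality

[m%d+n]%d≡[m+n]%d : ∀ m n d .{{_ : NonZero d}} → (m % d + n) % d ≡ (m + n) % d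
[m%d+n]%d≡[m+n]%d m n d = begin
  (m % d + n) % d           ≡⟨ %-distribˡ-+ (m % d) n d ⟩
  (m % d % d + n % d) % d   ≡⟨ cong (λ x → (x + n % d) % d) (m%n%n≡m%n m d) ⟩
  (m % d + n % d) % d       ≡⟨ %-distribˡ-+ m n d ⟨
  (m + n) % d               ∎
  where open ≡-Reasoning

-- Adding m * y subtracts y modulo suc m.
[[x+y]mod[1+m]+m*y]mod[1+m]≡x : ∀ m (x : Fin (suc m)) y →
  (toℕ ((toℕ x + y) mod suc m) + m * y) mod suc m ≡ x
[[x+y]mod[1+m]+m*y]mod[1+m]≡x m x y = toℕ-injective (begin
  toℕ ((toℕ ((toℕ x + y) mod suc m) + m * y) mod suc m)
                                          ≡⟨ toℕ-fromℕ< _ ⟩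
  (toℕ ((toℕ x + y) mod suc m) + m * y) % suc m
                                          ≡⟨ cong (λ z → (z + m * y) % suc m) (toℕ-fromℕ< (m%n<n (toℕ x + y) (suc m))) ⟩
  ((toℕ x + y) % suc m + m * y) % suc m   ≡⟨ [m%d+n]%d≡[m+n]%d (toℕ x + y) (m * y) (suc m) ⟩
  (toℕ x + y + m * y) % suc m             ≡⟨ cong (_% suc m) (+-assoc (toℕ x) y (m * y)) ⟩
  (toℕ x + suc m * y) % suc m             ≡⟨ cong (λ z → (toℕ x + z) % suc m) (*-comm (suc m) y) ⟩
  (toℕ x + y * suc m) % suc m             ≡⟨ [m+kn]%n≡m%n (toℕ x) y (suc m) ⟩
  toℕ x % suc m                           ≡⟨ m<n⇒m%n≡m (toℕ<n x) ⟩
  toℕ x                                   ∎)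
  where open ≡-Reasoning

first-inning-precedes : ∀ {n} {I : Fin n → ℕ} {a₀ : Fin n} → (∀ a → 1 ≤ I a) →
  I a₀ ≡ 1 → (∀ b → I b ≡ 1 → b ≡ a₀) → ∀ a → a ≢ a₀ → I a₀ < I a
first-inning-precedes {I = I} positive Ia₀≡1 unique a a≢a₀ =
  ≤∧≢⇒< (subst (_≤ I a) (sym Ia₀≡1) (positive a)) (λ Ia₀≡Ia → a≢a₀ (unique a (trans (sym Ia₀≡Ia) Ia₀≡1)))

sum-split : ∀ {n} (w u : Vector ℕ n) (i : Fin n) →
  u i ≡ 0 → (∀ j → j ≢ i → u j ≡ w j) → sum w ≡ w i + sum u
sum-split {suc n} w u i uᵢ≡0 u≡w = begin
  sum w                              ≡⟨ sum-remove {i = i} w ⟩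
  w i + sum (removeAt w i)           ≡⟨ cong (w i +_) (sum-cong-≗ (λ j → sym (u≡w (punchIn i j) (punchInᵢ≢i i j)))) ⟩
  w i + sum (removeAt u i)           ≡⟨ cong (λ x → w i + (x + sum (removeAt u i))) uᵢ≡0 ⟨
  w i + (u i + sum (removeAt u i))   ≡⟨ cong (w i +_) (sum-remove {i = i} u) ⟨
  w i + sum u                        ∎
  where open ≡-Reasoning

module Encoding {n m : ℕ} (V : Visibility n) (I : Fin n → ℕ) (a₀ : Fin n) where

  K : ℕ
  K = suc m

  known : (a : Fin n) →
    ((b : Fin n) → I b < I a → Fin K) → ((b : Fin n) → V a b ≡ true → Fin K) → Vector ℕ n
  known a h v c with c ≟ a₀ | I c <? I a | V a c ≟ᵇ true
  ... | yes _ | _       | _        = 0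
  ... | no _  | yes c<a | _        = toℕ (h c c<a)
  ... | no _  | no _    | yes sees = toℕ (v c sees)
  ... | no _  | no _    | no _     = 0

  strategy : (a : Fin n) → Strategy K V I a
  strategy a h v with I a₀ <? I a
  ... | yes a₀<a = (toℕ (h a₀ a₀<a) + m * sum (known a h v)) mod K
  ... | no _     = sum (known a h v) mod K

  hats : Coloring n K → Vector ℕ n
  hats f = updateAt (toℕ ∘ f) a₀ (const 0)

  predictor : Coloring n K → Coloring n K
  predictor f = updateAt f a₀ (const (sum (hats f) mod K))

  known-in-play : Coloring n K → Fin n → Vector ℕ n
  known-in-play f a = known a (λ b _ → predictor f b) (λ b _ → f b)

  module _ (loopless : Loopless V) (a₀-first : ∀ a → a ≢ a₀ → I a₀ < I a) (s2 : S2 V I) where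

    known-self : ∀ a h v → known a h v a ≡ 0
    known-self a h v with a ≟ a₀ | I a <? I a | V a a ≟ᵇ true
    ... | yes _ | _       | _        = refl
    ... | no _  | yes a<a | _        = ⊥-elim (<-irrefl refl a<a)
    ... | no _  | no _    | yes sees = contradiction (trans (sym sees) (loopless a)) λ ()
    ... | no _  | no _    | no _     = refl

    known-in-play≡hats : ∀ f a c → c ≢ a → known-in-play f a c ≡ hats f c
    known-in-play≡hats f a c c≢a with c ≟ a₀ | I c <? I a | V a c ≟ᵇ true
    ... | yes refl | _      | _         = sym (updateAt-updates a₀ (toℕ ∘ f))
    ... | no c≢a₀  | yes _  | _         =
      trans (cong toℕ (updateAt-minimal c a₀ f c≢a₀)) (sym (updateAt-minimal c a₀ (toℕ ∘ f) c≢a₀))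
    ... | no c≢a₀  | no _   | yes _     = sym (updateAt-minimal c a₀ (toℕ ∘ f) c≢a₀)
    ... | no _     | no c≮a | no unseen with proj₂ (s2 a c) c≢a
    ...   | inj₁ sees = contradiction sees unseen
    ...   | inj₂ c<a  = ⊥-elim (c≮a c<a)

    sum-hats : ∀ f a → sum (hats f) ≡ hats f a + sum (known-in-play f a)
    sum-hats f a = sum-split (hats f) (known-in-play f a) a (known-self a _ _) (known-in-play≡hats f a)

    induced : InducedBy V I strategy predictor
    induced f a with a ≟ a₀ | I a₀ <? I a
    ... | yes refl | yes a₀<a₀ = ⊥-elim (<-irrefl refl a₀<a₀)
    ... | yes refl | no _      = begin
      predictor f a₀             ≡⟨ updateAt-updates a₀ f ⟩
      sum (hats f) mod K         ≡⟨ cong (_mod K) (sum-hats f a₀) ⟩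
      (hats f a₀ + s) mod K      ≡⟨ cong (λ x → (x + s) mod K) (updateAt-updates a₀ (toℕ ∘ f)) ⟩
      s mod K                    ∎
      where
      open ≡-Reasoning
      s = sum (known-in-play f a₀)
    ... | no a≢a₀  | yes a₀<a  = begin
      predictor f a                                 ≡⟨ updateAt-minimal a a₀ f a≢a₀ ⟩
      f a                                           ≡⟨ [[x+y]mod[1+m]+m*y]mod[1+m]≡x m (f a) s ⟨
      (toℕ ((toℕ (f a) + s) mod K) + m * s) mod K   ≡⟨ cong (λ x → (toℕ (x mod K) + m * s) mod K) hats-a ⟨
      (toℕ (sum (hats f) mod K) + m * s) mod K      ≡⟨ cong (λ x → (toℕ x + m * s) mod K) (updateAt-updates a₀ f) ⟨
      (toℕ (predictor f a₀) + m * s) mod K          ∎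
      where
      open ≡-Reasoning
      s = sum (known-in-play f a)
      hats-a : sum (hats f) ≡ toℕ (f a) + s
      hats-a = trans (sum-hats f a) (cong (_+ s) (updateAt-minimal a a₀ (toℕ ∘ f) a≢a₀))
    ... | no a≢a₀  | no a₀≮a   = ⊥-elim (a₀≮a (a₀-first a a≢a₀))

    at-most-one-wrong : AtMostOneWrong predictor
    at-most-one-wrong f a b wrongᵃ wrongᵇ = trans (only-a₀-wrong a wrongᵃ) (sym (only-a₀-wrong b wrongᵇ))
      where
      only-a₀-wrong : ∀ c → predictor f c ≢ f c → c ≡ a₀
      only-a₀-wrong c wrong with c ≟ a₀
      ... | yes c≡a₀ = c≡a₀
      ... | no c≢a₀  = ⊥-elim (wrong (updateAt-minimal c a₀ f c≢a₀))

theorem4p3 : (n k : ℕ) → 2 ≤ n → 3 ≤ k →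
    (V : Visibility n) → Loopless V →
    (I : Fin n → ℕ) (α : ℕ) → IsInning I α → 2 ≤ α →
    S1 I → S2 V I →
    Σ (Coloring n k → Coloring n k) λ P → IsPredictor V I P × AtMostOneWrong P
theorem4p3 n (suc m) _ _ V loopless I _ (inning , _) _ (a₀ , Ia₀≡1 , unique) s2 =
  predictor , (strategy , induced loopless a₀-first s2) , at-most-one-wrong loopless a₀-first s2
  where
  open Encoding {m = m} V I a₀
  a₀-first : ∀ a → a ≢ a₀ → I a₀ < I a
  a₀-first = first-inning-precedes (proj₁ ∘ inning) Ia₀≡1 unique
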